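{- Let $(\alpha_n,\beta_n)$ be a Bailey pair relative to $a$ (with $a,q$ generic). Define $\alpha^*_0=\beta^*_0=1$ and, for $n\ge1$, \[ \alpha^*_n=(aq^{n}+q^{ -n})\alpha_n,\qquad \beta^*_n=\frac{(1+aq^{2n})\beta_n-\beta_{n-1}}{q^{n}}-\frac{a}{(aq,q;q)_{n}}. \] Then $(\alpha^*_n,\beta^*_n)$ is a Bailey pair relative to $a$.
   Context: For $n\ge0$, $(x;q)_n=\prod_{i=0}^{n-1}(1-xq^i)$ and $(x_1,\dots,x_j;q)_n=(x_1;q)_n\cdots(x_j;q)_n$. A pair of sequences $(\alpha_n,\beta_n)_{n\ge0}$ is a Bailey pair relative to $a$ if $\alpha_0=1$ and for all $n\ge0$, $\beta_n=\sum_{r=0}^n\frac{\alpha_r}{(q;q)_{n-r}(aq;q)_{n+r}}$. -}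

module Defs where

open import Level using (Level; _⊔_) renaming (suc to lsuc)
open import Data.Nat using (ℕ; zero; suc) renaming (_+_ to _+ℕ_; _∸_ to _∸ℕ_)
open import Data.Product using (_×_)
open import Relation.Nullary using (¬_)
open import Algebra.Bundles using (CommutativeRing)

-- A field: a commutative ring with 1 ≉ 0 and a (total) inverse function
-- which is a genuine multiplicative inverse on every nonzero element.
-- (The value of 0⁻¹ is irrelevant: it is never used under our hypotheses.)
record Field (c ℓ : Level) : Set (lsuc (c ⊔ ℓ)) where
  field
    commutativeRing : CommutativeRing c ℓ
  open CommutativeRing commutativeRing public
  field
    _⁻¹      : Carrier → Carrier
    1≉0      : ¬ (1# ≈ 0#)
    ⁻¹-inverse : ∀ x → ¬ (x ≈ 0#) → (x * (x ⁻¹)) ≈ 1#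

module _ {c ℓ : Level} (F : Field c ℓ) where
  open Field F

  pow : Carrier → ℕ → Carrier
  pow x zero    = 1#
  pow x (suc n) = x * pow x n

  poch : Carrier → Carrier → ℕ → Carrier
  poch x q zero    = 1#
  poch x q (suc n) = poch x q n * (1# - x * pow q n)

  sumTo : ℕ → (ℕ → Carrier) → Carrier
  sumTo zero    f = f 0
  sumTo (suc n) f = sumTo n f + f (suc n)

  IsBaileyPair : (a q : Carrier) → (α β : ℕ → Carrier) → Set ℓ
  IsBaileyPair a q α β =
    (α 0 ≈ 1#) ×
    (∀ n → β n ≈ sumTo n (λ r →
        α r * ((poch q q (n ∸ℕ r) * poch (a * q) q (n +ℕ r)) ⁻¹)))

  αStar : (a q : Carrier) → (α : ℕ → Carrier) → ℕ → Carrier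
  αStar a q α zero    = 1#
  αStar a q α (suc m) =
    (a * pow q (suc m) + (pow q (suc m)) ⁻¹) * α (suc m)

  βStar : (a q : Carrier) → (β : ℕ → Carrier) → ℕ → Carrier
  βStar a q β zero    = 1#
  βStar a q β (suc m) =
    ((1# + a * pow q (suc m +ℕ suc m)) * β (suc m) - β m) * ((pow q (suc m)) ⁻¹)
    - a * ((poch (a * q) q (suc m) * poch q q (suc m)) ⁻¹)

-- Write K(n,r) = 1/((q;q)_{n-r} (aq;q)_{n+r}), so that β_n = Σ_{r≤n} α_r K(n,r).
-- For r < n, K(n-1,r) = K(n,r)(1 - q^{n-r})(1 - aq^{n+r}), and expanding the product gives
--   (1 + aq^{2n}) K(n,r) - K(n-1,r) = q^n (aq^r + q^{-r}) K(n,r),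
-- while for r = n the same holds without the K(n-1,n) term. Summing against α_r,
-- ((1 + aq^{2n}) β_n - β_{n-1}) / q^n = Σ_{r≤n} (aq^r + q^{-r}) α_r K(n,r); here the r = 0 term is
-- (a + 1) K(n,0), which exceeds α*_0 K(n,0) by exactly a/(aq,q;q)_n.

module Submission where

open import Defs
open import Level using (Level)
open import Data.Nat as ℕ using (ℕ; zero; suc; _≤_)
import Data.Nat.Properties as ℕₚ
open import Data.Integer as ℤ using (ℤ; +_; -[1+_]; _⊖_; sign; ∣_∣; _◃_)
import Data.Integer.Properties as ℤₚ
open import Data.Sign as Sign using (Sign)
open import Data.Maybe using (map)
open import Data.Product using (_,_)
open import Relation.Nullary using (¬_)
import Relation.Binary.PropositionalEquality as ≡
open import Relation.Binary.Consequences using (dec⇒weaklyDec)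
open import Relation.Binary.Definitions using (WeaklyDecidable)
open import Algebra.Bundles using (CommutativeRing)
open import Algebra.Solver.Ring.AlmostCommutativeRing
  using (fromCommutativeRing; _-Raw-AlmostCommutative⟶_; Induced-equivalence)

-- Over the carrier's own coefficients normal forms would not compute (there is no zero test), so
-- the ring solver is instantiated with integer coefficients mapped into the ring.
module IntegerCoefficientRingSolver {c ℓ : Level} (R : CommutativeRing c ℓ) where
  open CommutativeRing R
  open import Algebra.Properties.Semiring.Mult.TCOptimised semiring using (_×_; 1+×; ×-homo-+; ×1-homo-*)
  open import Algebra.Properties.Ring ring using (-1*x≈-x)
  open import Algebra.Properties.AbelianGroup +-abelianGroup using (⁻¹-∙-comm; ⁻¹-involutive; ε⁻¹≈ε)
  open import Algebra.Properties.CommutativeSemigroup +-commutativeSemigroup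
    using () renaming (interchange to +-interchange)
  open import Algebra.Properties.CommutativeSemigroup *-commutativeSemigroup
    using () renaming (interchange to *-interchange)
  open import Relation.Binary.Reasoning.Setoid setoid

  ⟦_⟧ℤ : ℤ → Carrier
  ⟦ + n ⟧ℤ     = n × 1#
  ⟦ -[1+ n ] ⟧ℤ = - (suc n × 1#)

  ⊖-homo : ∀ m n → ⟦ m ⊖ n ⟧ℤ ≈ m × 1# - n × 1#
  ⊖-homo m       zero    = sym (trans (+-congˡ ε⁻¹≈ε) (+-identityʳ _))
  ⊖-homo zero    (suc n) = sym (+-identityˡ _)
  ⊖-homo (suc m) (suc n) rewrite ℤₚ.[1+m]⊖[1+n]≡m⊖n m n = begin
    ⟦ m ⊖ n ⟧ℤ                              ≈⟨ ⊖-homo m n ⟩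
    m × 1# - n × 1#                         ≈⟨ +-identityˡ _ ⟨
    0# + (m × 1# - n × 1#)                  ≈⟨ +-congʳ (-‿inverseʳ 1#) ⟨
    (1# - 1#) + (m × 1# - n × 1#)           ≈⟨ +-interchange _ _ _ _ ⟩
    (1# + m × 1#) + (- 1# - n × 1#)         ≈⟨ +-congˡ (⁻¹-∙-comm _ _) ⟩
    (1# + m × 1#) - (1# + n × 1#)           ≈⟨ +-cong (1+× m 1#) (-‿cong (1+× n 1#)) ⟨
    suc m × 1# - suc n × 1#                 ∎

  -‿homo : ∀ i → ⟦ ℤ.- i ⟧ℤ ≈ - ⟦ i ⟧ℤ
  -‿homo (+ zero)  = sym ε⁻¹≈ε
  -‿homo (+ suc n) = refl
  -‿homo -[1+ n ]  = sym (⁻¹-involutive _)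

  +-homo : ∀ i j → ⟦ i ℤ.+ j ⟧ℤ ≈ ⟦ i ⟧ℤ + ⟦ j ⟧ℤ
  +-homo (+ m)    (+ n)    = ×-homo-+ 1# m n
  +-homo (+ m)    -[1+ n ] = ⊖-homo m (suc n)
  +-homo -[1+ m ] (+ n)    = trans (⊖-homo n (suc m)) (+-comm _ _)
  +-homo -[1+ m ] -[1+ n ] = begin
    - (suc (suc (m ℕ.+ n)) × 1#)      ≡⟨ ≡.cong (λ k → - (suc k × 1#)) (ℕₚ.+-suc m n) ⟨
    - ((suc m ℕ.+ suc n) × 1#)        ≈⟨ -‿cong (×-homo-+ 1# (suc m) (suc n)) ⟩
    - (suc m × 1# + suc n × 1#)       ≈⟨ ⁻¹-∙-comm _ _ ⟨
    - (suc m × 1#) + - (suc n × 1#)   ∎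

  ⟦_⟧± : Sign → Carrier
  ⟦ Sign.+ ⟧± = 1#
  ⟦ Sign.- ⟧± = - 1#

  ±-homo : ∀ s t → ⟦ s Sign.* t ⟧± ≈ ⟦ s ⟧± * ⟦ t ⟧±
  ±-homo Sign.+ t      = sym (*-identityˡ _)
  ±-homo Sign.- Sign.+ = sym (*-identityʳ _)
  ±-homo Sign.- Sign.- = sym (trans (-1*x≈-x _) (⁻¹-involutive _))

  ◃-homo : ∀ s n → ⟦ s ◃ n ⟧ℤ ≈ ⟦ s ⟧± * n × 1#
  ◃-homo s      zero    = sym (zeroʳ _)
  ◃-homo Sign.+ (suc n) = sym (*-identityˡ _)
  ◃-homo Sign.- (suc n) = sym (-1*x≈-x _)

  ⟦⟧ℤ-signAbs : ∀ i → ⟦ i ⟧ℤ ≈ ⟦ sign i ⟧± * ∣ i ∣ × 1#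
  ⟦⟧ℤ-signAbs i = trans (reflexive (≡.cong ⟦_⟧ℤ (≡.sym (ℤₚ.◃-inverse i)))) (◃-homo (sign i) ∣ i ∣)

  *-homo : ∀ i j → ⟦ i ℤ.* j ⟧ℤ ≈ ⟦ i ⟧ℤ * ⟦ j ⟧ℤ
  *-homo i j = begin
    ⟦ i ℤ.* j ⟧ℤ                                                 ≈⟨ ◃-homo (sign i Sign.* sign j) (∣ i ∣ ℕ.* ∣ j ∣) ⟩
    ⟦ sign i Sign.* sign j ⟧± * (∣ i ∣ ℕ.* ∣ j ∣) × 1#             ≈⟨ *-cong (±-homo (sign i) (sign j)) (×1-homo-* ∣ i ∣ ∣ j ∣) ⟩
    (⟦ sign i ⟧± * ⟦ sign j ⟧±) * (∣ i ∣ × 1# * ∣ j ∣ × 1#)       ≈⟨ *-interchange _ _ _ _ ⟩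
    (⟦ sign i ⟧± * ∣ i ∣ × 1#) * (⟦ sign j ⟧± * ∣ j ∣ × 1#)       ≈⟨ *-cong (⟦⟧ℤ-signAbs i) (⟦⟧ℤ-signAbs j) ⟨
    ⟦ i ⟧ℤ * ⟦ j ⟧ℤ                                              ∎

  embedding : ℤ.+-*-rawRing -Raw-AlmostCommutative⟶ fromCommutativeRing R
  embedding = record
    { ⟦_⟧    = ⟦_⟧ℤ
    ; +-homo = +-homo
    ; *-homo = *-homo
    ; -‿homo = -‿homo
    ; 0-homo = refl
    ; 1-homo = refl
    }

  _≟ℤ_ : WeaklyDecidable (Induced-equivalence embedding)
  i ≟ℤ j = map (λ i≡j → reflexive (≡.cong ⟦_⟧ℤ i≡j)) (dec⇒weaklyDec ℤ._≟_ i j)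

  open import Algebra.Solver.Ring ℤ.+-*-rawRing (fromCommutativeRing R) embedding _≟ℤ_ public

module FieldProperties {c ℓ : Level} (F : Field c ℓ) where
  open Field F
  open IntegerCoefficientRingSolver commutativeRing using (solve; _:=_; _:+_; _:*_; _:-_)
  open import Relation.Binary.Reasoning.Setoid setoid

  private
    variable
      x y z u : Carrier

  x*y≈z⇒y≈z*x⁻¹ : x ≉ 0# → x * y ≈ z → y ≈ z * x ⁻¹
  x*y≈z⇒y≈z*x⁻¹ {x} {y} {z} x≉0 x*y≈z = begin
    y                ≈⟨ *-identityˡ y ⟨
    1# * y           ≈⟨ *-congʳ (trans (*-comm _ x) (⁻¹-inverse x x≉0)) ⟨
    (x ⁻¹ * x) * y   ≈⟨ *-assoc _ _ _ ⟩
    x ⁻¹ * (x * y)   ≈⟨ *-congˡ x*y≈z ⟩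
    x ⁻¹ * z         ≈⟨ *-comm _ _ ⟩
    z * x ⁻¹         ∎

  x*y≈1⇒y≈x⁻¹ : x ≉ 0# → x * y ≈ 1# → y ≈ x ⁻¹
  x*y≈1⇒y≈x⁻¹ x≉0 x*y≈1 = trans (x*y≈z⇒y≈z*x⁻¹ x≉0 x*y≈1) (*-identityˡ _)

  *-≉0 : x ≉ 0# → y ≉ 0# → x * y ≉ 0#
  *-≉0 x≉0 y≉0 x*y≈0 = y≉0 (trans (x*y≈z⇒y≈z*x⁻¹ x≉0 x*y≈0) (zeroˡ _))

  ⁻¹-cong : x ≉ 0# → x ≈ y → x ⁻¹ ≈ y ⁻¹
  ⁻¹-cong {x} {y} x≉0 x≈y = x*y≈1⇒y≈x⁻¹ (λ y≈0 → x≉0 (trans x≈y y≈0))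
    (trans (*-congʳ (sym x≈y)) (⁻¹-inverse x x≉0))

  1⁻¹≈1 : 1# ⁻¹ ≈ 1#
  1⁻¹≈1 = sym (x*y≈1⇒y≈x⁻¹ 1≉0 (*-identityˡ 1#))

  y≈x*u⇒x⁻¹≈y⁻¹*u : x ≉ 0# → y ≉ 0# → y ≈ x * u → x ⁻¹ ≈ y ⁻¹ * u
  y≈x*u⇒x⁻¹≈y⁻¹*u {x} {y} {u} x≉0 y≉0 y≈x*u = sym (x*y≈1⇒y≈x⁻¹ x≉0 (begin
    x * (y ⁻¹ * u)   ≈⟨ solve 3 (λ x y′ u → x :* (y′ :* u) := y′ :* (x :* u)) refl x (y ⁻¹) u ⟩
    y ⁻¹ * (x * u)   ≈⟨ *-congˡ y≈x*u ⟨
    y ⁻¹ * y         ≈⟨ *-comm _ _ ⟩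
    y * y ⁻¹         ≈⟨ ⁻¹-inverse y y≉0 ⟩
    1#               ∎))

  pow-+ : ∀ x m n → pow F x (m ℕ.+ n) ≈ pow F x m * pow F x n
  pow-+ x zero    n = sym (*-identityˡ _)
  pow-+ x (suc m) n = trans (*-congˡ (pow-+ x m n)) (sym (*-assoc _ _ _))

  pow-≉0 : x ≉ 0# → ∀ n → pow F x n ≉ 0#
  pow-≉0 x≉0 zero    = 1≉0
  pow-≉0 x≉0 (suc n) = *-≉0 x≉0 (pow-≉0 x≉0 n)

  poch-≉0 : ∀ {x q} → (∀ k → 1# - x * pow F q k ≉ 0#) → ∀ n → poch F x q n ≉ 0#
  poch-≉0 factor≉0 zero    = 1≉0
  poch-≉0 factor≉0 (suc n) = *-≉0 (poch-≉0 factor≉0 n) (factor≉0 n)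

  sumTo-cong : ∀ n {f g : ℕ → Carrier} → (∀ r → r ≤ n → f r ≈ g r) → sumTo F n f ≈ sumTo F n g
  sumTo-cong zero    f≈g = f≈g 0 ℕ.z≤n
  sumTo-cong (suc n) f≈g =
    +-cong (sumTo-cong n (λ r r≤n → f≈g r (ℕₚ.m≤n⇒m≤1+n r≤n))) (f≈g (suc n) ℕₚ.≤-refl)

  sumTo-*ˡ : ∀ n x (f : ℕ → Carrier) → sumTo F n (λ r → x * f r) ≈ x * sumTo F n f
  sumTo-*ˡ zero    x f = refl
  sumTo-*ˡ (suc n) x f = trans (+-congʳ (sumTo-*ˡ n x f)) (sym (distribˡ x _ _))

  sumTo-*ʳ : ∀ n x (f : ℕ → Carrier) → sumTo F n (λ r → f r * x) ≈ sumTo F n f * x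
  sumTo-*ʳ zero    x f = refl
  sumTo-*ʳ (suc n) x f = trans (+-congʳ (sumTo-*ʳ n x f)) (sym (distribʳ x _ _))

  sumTo-- : ∀ n (f g : ℕ → Carrier) → sumTo F n (λ r → f r - g r) ≈ sumTo F n f - sumTo F n g
  sumTo-- zero    f g = refl
  sumTo-- (suc n) f g = trans (+-congʳ (sumTo-- n f g))
    (solve 4 (λ Σf Σg f′ g′ → Σf :- Σg :+ (f′ :- g′) := Σf :+ f′ :- (Σg :+ g′))
      refl (sumTo F n f) (sumTo F n g) (f (suc n)) (g (suc n)))

  sumTo-offset₀ : ∀ n {f g : ℕ → Carrier} x → f 0 ≈ g 0 + x →
                  (∀ j → suc j ≤ n → f (suc j) ≈ g (suc j)) → sumTo F n f ≈ sumTo F n g + x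
  sumTo-offset₀ zero          x f₀≈g₀+x _   = f₀≈g₀+x
  sumTo-offset₀ (suc n) {f} {g} x f₀≈g₀+x f≈g = begin
    sumTo F n f + f (suc n)         ≈⟨ +-cong (sumTo-offset₀ n x f₀≈g₀+x (λ j j<n → f≈g j (ℕₚ.m≤n⇒m≤1+n j<n)))
                                              (f≈g n ℕₚ.≤-refl) ⟩
    sumTo F n g + x + g (suc n)     ≈⟨ solve 3 (λ Σg x g′ → Σg :+ x :+ g′ := Σg :+ g′ :+ x) refl (sumTo F n g) x (g (suc n)) ⟩
    sumTo F n g + g (suc n) + x     ∎

module BaileyPairs {c ℓ : Level} (F : Field c ℓ) (a q : Field.Carrier F) where
  open Field F
  open FieldProperties F
  open IntegerCoefficientRingSolver commutativeRing using (solve; _:=_; _:+_; _:*_; _:-_; con)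
  open import Relation.Binary.Reasoning.Setoid setoid
  open import Algebra.Properties.CommutativeSemigroup *-commutativeSemigroup
    using () renaming (interchange to *-interchange)

  denominator : ℕ → ℕ → Carrier
  denominator n r = poch F q q (n ℕ.∸ r) * poch F (a * q) q (n ℕ.+ r)

  kernel : ℕ → ℕ → Carrier
  kernel n r = denominator n r ⁻¹

  baileyTransform : (ℕ → Carrier) → ℕ → Carrier
  baileyTransform α n = sumTo F n (λ r → α r * kernel n r)

  weight : ℕ → Carrier
  weight r = a * pow F q r + pow F q r ⁻¹

  1+aq²ⁿ : ℕ → Carrier
  1+aq²ⁿ n = 1# + a * pow F q (n ℕ.+ n)

  βStar-cong : ∀ {β β′} → (∀ n → β n ≈ β′ n) → ∀ n → βStar F a q β n ≈ βStar F a q β′ n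
  βStar-cong β≈β′ zero    = refl
  βStar-cong β≈β′ (suc m) = +-congʳ (*-congʳ (+-cong (*-congˡ (β≈β′ (suc m))) (-‿cong (β≈β′ m))))

  αStar-sum : ∀ {α} → α 0 ≈ 1# → ∀ n (K : ℕ → Carrier) →
              sumTo F n (λ r → αStar F a q α r * K r) ≈ sumTo F n (λ r → weight r * α r * K r) - a * K 0
  αStar-sum {α} α₀≈1 n K = sumTo-offset₀ n _ (begin
    1# * K 0
      ≈⟨ solve 2 (λ a K₀ → con (+ 1) :* K₀ := (a :* con (+ 1) :+ con (+ 1)) :* con (+ 1) :* K₀ :- a :* K₀) refl a (K 0) ⟩
    (a * 1# + 1#) * 1# * K 0 - a * K 0
      ≈⟨ +-congʳ (*-congʳ (*-cong (+-congˡ 1⁻¹≈1) α₀≈1)) ⟨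
    weight 0 * α 0 * K 0 - a * K 0
      ∎) (λ _ _ → refl)

  module _ (q≉0 : q ≉ 0#) (1-qⁱ⁺¹≉0 : ∀ i → 1# - pow F q (suc i) ≉ 0#)
           (1-aqⁱ⁺¹≉0 : ∀ i → 1# - a * pow F q (suc i) ≉ 0#) where

    denominator-≉0 : ∀ n r → denominator n r ≉ 0#
    denominator-≉0 n r = *-≉0 (poch-≉0 1-qⁱ⁺¹≉0 (n ℕ.∸ r)) (poch-≉0 1-aqᵏ⁺¹≉0 (n ℕ.+ r))
      where
      1-aqᵏ⁺¹≉0 : ∀ k → 1# - a * q * pow F q k ≉ 0#
      1-aqᵏ⁺¹≉0 k eq = 1-aqⁱ⁺¹≉0 k (trans (sym (+-congˡ (-‿cong (*-assoc a q _)))) eq)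

    kernel-0-0 : kernel 0 0 ≈ 1#
    kernel-0-0 = trans (⁻¹-cong (denominator-≉0 0 0) (*-identityˡ 1#)) 1⁻¹≈1

    kernel-at-0 : ∀ n → (poch F (a * q) q n * poch F q q n) ⁻¹ ≈ kernel n 0
    kernel-at-0 n = ⁻¹-cong (λ eq → denominator-≉0 n 0 (trans (sym reorder) eq)) reorder
      where
      reorder : poch F (a * q) q n * poch F q q n ≈ denominator n 0
      reorder = trans (*-comm _ _) (*-congˡ (reflexive (≡.cong (poch F (a * q) q) (≡.sym (ℕₚ.+-identityʳ n)))))

    kernel-step : ∀ {m r} → r ≤ m →
      kernel m r ≈ kernel (suc m) r * ((1# - pow F q (suc (m ℕ.∸ r))) * (1# - a * q * pow F q (m ℕ.+ r)))
    kernel-step {m} {r} r≤m = y≈x*u⇒x⁻¹≈y⁻¹*u (denominator-≉0 m r) (denominator-≉0 (suc m) r) (begin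
      denominator (suc m) r
        ≡⟨ ≡.cong (λ k → poch F q q k * poch F (a * q) q (suc m ℕ.+ r)) (ℕₚ.+-∸-assoc 1 r≤m) ⟩
      poch F q q (m ℕ.∸ r) * (1# - pow F q (suc (m ℕ.∸ r))) * (poch F (a * q) q (m ℕ.+ r) * (1# - a * q * pow F q (m ℕ.+ r)))
        ≈⟨ *-interchange _ _ _ _ ⟩
      denominator m r * ((1# - pow F q (suc (m ℕ.∸ r))) * (1# - a * q * pow F q (m ℕ.+ r)))
        ∎)

    weight-factors : ∀ {m r} → r ≤ m →
      weight r ≈ (1+aq²ⁿ (suc m) - (1# - pow F q (suc (m ℕ.∸ r))) * (1# - a * q * pow F q (m ℕ.+ r))) * pow F q (suc m) ⁻¹
    weight-factors {m} {r} r≤m = x*y≈z⇒y≈z*x⁻¹ (pow-≉0 q≉0 (suc m)) (begin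
      Z * (a * S + S ⁻¹)                                   ≈⟨ *-congʳ X*S≈Z ⟨
      X * S * (a * S + S ⁻¹)
        ≈⟨ solve 4 (λ a X S S′ → X :* S :* (a :* S :+ S′) := a :* X :* S :* S :+ X :* (S :* S′)) refl a X S (S ⁻¹) ⟩
      a * X * S * S + X * (S * S ⁻¹)                       ≈⟨ +-congˡ (*-congˡ (⁻¹-inverse S (pow-≉0 q≉0 r))) ⟩
      a * X * S * S + X * 1#
        ≈⟨ solve 3 (λ a X S → a :* X :* S :* S :+ X :* con (+ 1)
                             := con (+ 1) :+ a :* (X :* S :* (X :* S)) :- (con (+ 1) :- X) :* (con (+ 1) :- a :* (X :* S) :* S))
             refl a X S ⟩
      1# + a * (X * S * (X * S)) - (1# - X) * (1# - a * (X * S) * S)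
        ≈⟨ +-cong (+-congˡ (*-congˡ (*-cong X*S≈Z X*S≈Z))) (-‿cong (*-congˡ (+-congˡ (-‿cong (*-congʳ (*-congˡ X*S≈Z)))))) ⟩
      1# + a * (Z * Z) - (1# - X) * (1# - a * Z * S)
        ≈⟨ +-cong (+-congˡ (*-congˡ (pow-+ q (suc m) (suc m)))) (-‿cong (*-congˡ (+-congˡ (-‿cong aq·qᵐ⁺ʳ≈aZS)))) ⟨
      1+aq²ⁿ (suc m) - (1# - X) * (1# - a * q * pow F q (m ℕ.+ r)) ∎)
      where
      X = pow F q (suc (m ℕ.∸ r))
      S = pow F q r
      Z = pow F q (suc m)
      X*S≈Z : X * S ≈ Z
      X*S≈Z = trans (sym (pow-+ q (suc (m ℕ.∸ r)) r)) (reflexive (≡.cong (λ k → pow F q (suc k)) (ℕₚ.m∸n+n≡m r≤m)))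
      aq·qᵐ⁺ʳ≈aZS : a * q * pow F q (m ℕ.+ r) ≈ a * Z * S
      aq·qᵐ⁺ʳ≈aZS = trans (*-assoc a q _) (trans (*-congˡ (pow-+ q (suc m) r)) (sym (*-assoc a Z S)))

    weight-kernel : ∀ {m r} → r ≤ m →
      weight r * kernel (suc m) r ≈ (1+aq²ⁿ (suc m) * kernel (suc m) r - kernel m r) * pow F q (suc m) ⁻¹
    weight-kernel {m} {r} r≤m = begin
      weight r * K                        ≈⟨ *-comm _ _ ⟩
      K * weight r                        ≈⟨ *-congˡ (weight-factors r≤m) ⟩
      K * ((C - U * V) * Z⁻¹)             ≈⟨ solve 5 (λ K C U V Z⁻¹ → K :* ((C :- U :* V) :* Z⁻¹) := (C :* K :- K :* (U :* V)) :* Z⁻¹) refl K C U V Z⁻¹ ⟩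
      (C * K - K * (U * V)) * Z⁻¹         ≈⟨ *-congʳ (+-congˡ (-‿cong (kernel-step r≤m))) ⟨
      (C * K - kernel m r) * Z⁻¹          ∎
      where
      K = kernel (suc m) r
      C = 1+aq²ⁿ (suc m)
      U = 1# - pow F q (suc (m ℕ.∸ r))
      V = 1# - a * q * pow F q (m ℕ.+ r)
      Z⁻¹ = pow F q (suc m) ⁻¹

    weight-top : ∀ n → weight n ≈ 1+aq²ⁿ n * pow F q n ⁻¹
    weight-top n = x*y≈z⇒y≈z*x⁻¹ (pow-≉0 q≉0 n) (begin
      Z * (a * Z + Z ⁻¹)           ≈⟨ solve 3 (λ a Z Z′ → Z :* (a :* Z :+ Z′) := Z :* Z′ :+ a :* (Z :* Z)) refl a Z (Z ⁻¹) ⟩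
      Z * Z ⁻¹ + a * (Z * Z)       ≈⟨ +-cong (⁻¹-inverse Z (pow-≉0 q≉0 n)) (*-congˡ (sym (pow-+ q n n))) ⟩
      1+aq²ⁿ n                     ∎)
      where
      Z = pow F q n

    weightedSum-recurrence : ∀ α m →
      sumTo F (suc m) (λ r → weight r * α r * kernel (suc m) r)
        ≈ (1+aq²ⁿ (suc m) * baileyTransform α (suc m) - baileyTransform α m) * pow F q (suc m) ⁻¹
    weightedSum-recurrence α m = begin
      sumTo F m (λ r → weight r * α r * K₁ r) + weight n * α n * K₁ n
        ≈⟨ +-cong (sumTo-cong m (λ r r≤m → summand r≤m)) top ⟩
      sumTo F m (λ r → (C * (α r * K₁ r) - α r * K₀ r) * Z⁻¹) + C * (α n * K₁ n) * Z⁻¹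
        ≈⟨ +-congʳ (trans (sumTo-*ʳ m Z⁻¹ _) (*-congʳ (trans (sumTo-- m _ _) (+-congʳ (sumTo-*ˡ m C _))))) ⟩
      (C * sumTo F m (λ r → α r * K₁ r) - baileyTransform α m) * Z⁻¹ + C * (α n * K₁ n) * Z⁻¹
        ≈⟨ solve 5 (λ C Σ₁ Σ₀ t Z⁻¹ → (C :* Σ₁ :- Σ₀) :* Z⁻¹ :+ C :* t :* Z⁻¹ := (C :* (Σ₁ :+ t) :- Σ₀) :* Z⁻¹)
             refl C (sumTo F m (λ r → α r * K₁ r)) (baileyTransform α m) (α n * K₁ n) Z⁻¹ ⟩
      (C * baileyTransform α n - baileyTransform α m) * Z⁻¹
        ∎
      where
      n = suc m
      K₁ = kernel n
      K₀ = kernel m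
      C = 1+aq²ⁿ n
      Z⁻¹ = pow F q n ⁻¹
      summand : ∀ {r} → r ≤ m → weight r * α r * K₁ r ≈ (C * (α r * K₁ r) - α r * K₀ r) * Z⁻¹
      summand {r} r≤m = begin
        weight r * α r * K₁ r                ≈⟨ solve 3 (λ w α K → w :* α :* K := α :* (w :* K)) refl (weight r) (α r) (K₁ r) ⟩
        α r * (weight r * K₁ r)              ≈⟨ *-congˡ (weight-kernel r≤m) ⟩
        α r * ((C * K₁ r - K₀ r) * Z⁻¹)      ≈⟨ solve 5 (λ α C K Kₘ Z⁻¹ → α :* ((C :* K :- Kₘ) :* Z⁻¹) := (C :* (α :* K) :- α :* Kₘ) :* Z⁻¹)
                                                   refl (α r) C (K₁ r) (K₀ r) Z⁻¹ ⟩
        (C * (α r * K₁ r) - α r * K₀ r) * Z⁻¹ ∎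
      top : weight n * α n * K₁ n ≈ C * (α n * K₁ n) * Z⁻¹
      top = trans (*-congʳ (*-congʳ (weight-top n)))
        (solve 4 (λ C Z⁻¹ α K → C :* Z⁻¹ :* α :* K := C :* (α :* K) :* Z⁻¹) refl C Z⁻¹ (α n) (K₁ n))

    βStar-baileyTransform : ∀ {α} → α 0 ≈ 1# → ∀ n →
      βStar F a q (baileyTransform α) n ≈ baileyTransform (αStar F a q α) n
    βStar-baileyTransform α₀≈1 zero    = sym (trans (*-identityˡ _) kernel-0-0)
    βStar-baileyTransform {α} α₀≈1 (suc m) = begin
      (1+aq²ⁿ n * B n - B m) * pow F q n ⁻¹ - a * (poch F (a * q) q n * poch F q q n) ⁻¹
        ≈⟨ +-congˡ (-‿cong (*-congˡ (kernel-at-0 n))) ⟩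
      (1+aq²ⁿ n * B n - B m) * pow F q n ⁻¹ - a * kernel n 0
        ≈⟨ +-congʳ (weightedSum-recurrence α m) ⟨
      sumTo F n (λ r → weight r * α r * kernel n r) - a * kernel n 0
        ≈⟨ αStar-sum α₀≈1 n (kernel n) ⟨
      baileyTransform (αStar F a q α) n
        ∎
      where
      n = suc m
      B = baileyTransform α

mainTheorem3 : ∀ {c ℓ : Level} (F : Field c ℓ) (a q : Field.Carrier F) →
    ¬ (Field._≈_ F q (Field.0# F)) →
    (∀ (i : ℕ) → ¬ (Field._≈_ F (Field._-_ F (Field.1# F) (pow F q (suc i))) (Field.0# F))) →
    (∀ (i : ℕ) → ¬ (Field._≈_ F (Field._-_ F (Field.1# F) (Field._*_ F a (pow F q (suc i)))) (Field.0# F))) →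
    (α β : ℕ → Field.Carrier F) →
    IsBaileyPair F a q α β →
    IsBaileyPair F a q (αStar F a q α) (βStar F a q β)
mainTheorem3 F a q q≉0 1-qⁱ⁺¹≉0 1-aqⁱ⁺¹≉0 α β (α₀≈1 , β≈Bα) =
  refl , λ n → trans (βStar-cong β≈Bα n) (βStar-baileyTransform q≉0 1-qⁱ⁺¹≉0 1-aqⁱ⁺¹≉0 α₀≈1 n)
  where
  open Field F
  open BaileyPairs F a q
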